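{- For all integers $m\ge 2$ and all $n\in\mathbb{N}$, we have $g_{2m}(n)=2n$ if and only if $n$ is prime, or $n=0$, or $(2m,n)=(6,6)$.
   Context: $\mathbb{N}=\{0,1,2,\dots\}$. For an integer $m\ge 2$, an $m$-product sequence is a finite sequence of integers $a_1\le a_2\le\dots\le a_t$ such that $\prod_{i=1}^t a_i=R^m$ for some $R\in\mathbb{N}$ and no integer appears more than $m-1$ times in the sequence. For $n\in\mathbb{N}$, $g_m(n)$ is the least integer $s$ such that there exists an $m$-product sequence $a_1\le\dots\le a_t$ with $a_1=n$ and $a_t=s$. -}

module Defs where

open import Data.Nat using (ℕ; _≤_; _<_; _^_; _≟_)
open import Data.List using (List; []; _∷_; length; filter; last)
open import Data.Nat.ListAction using (product)
open import Data.List.Relation.Unary.Linked using (Linked)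
open import Data.Maybe using (just)
open import Data.Product using (_×_; ∃; ∃-syntax)
open import Relation.Binary.PropositionalEquality using (_≡_)

multiplicity : ℕ → List ℕ → ℕ
multiplicity x l = length (filter (x ≟_) l)

IsProductSeq : ℕ → List ℕ → Set
IsProductSeq m l =
  Linked _≤_ l × (∃[ R ] product l ≡ R ^ m) × (∀ x → multiplicity x l < m)

HasSeq : ℕ → ℕ → ℕ → Set
HasSeq m n s = ∃[ rest ] (IsProductSeq m (n ∷ rest) × last (n ∷ rest) ≡ just s)

-- g_m(n) = s : s is the least integer admitting such a sequence
GEq : ℕ → ℕ → ℕ → Set
GEq m n s = HasSeq m n s × (∀ s′ → HasSeq m n s′ → s ≤ s′)

-- Lower bounds: if a sequence starting at n ended below the claimed value, all its terms would lie in a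
-- window where the exponent of a prime (of p itself when n = p is prime; of 2, 3 and 5, weighted by 4, 3
-- and 2, when n = 6 and M = 6) counts the copies of n modulo M.  As the product is an M-th power, that
-- count, which lies between 1 and M - 1, would be a multiple of M.
-- Upper bounds: m copies of each term of n < x₁ < … < s with square product form a 2m-product sequence,
-- e.g. p < 2j² < 2p for primes p ≥ 5 and ab < a(b + 1) < (a + 1)b < (a + 1)(b + 1) for n = ab;
-- the remaining small cases n = 2, 3, 6 get explicit sequences.
module Submission where

open import Defs
open import Data.Fin using (zero; suc)
open import Data.List using (List; []; _∷_; _++_; [_]; map; filter; length; last; replicate)
open import Data.List.Properties
  using (filter-++; filter-accept; filter-reject; filter-none; length-filter; length-++; length-replicate; map-∘; map-id)
open import Data.List.Relation.Unary.All as All using (All; []; _∷_)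
import Data.List.Relation.Unary.All.Properties as All
open import Data.List.Relation.Unary.AllPairs using (AllPairs; []; _∷_)
import Data.List.Relation.Unary.AllPairs.Properties as AllPairs
open import Data.List.Relation.Unary.Linked using (Linked; [-]; _∷_)
open import Data.List.Relation.Unary.Linked.Properties as Linked using (Linked⇒All; Linked⇒AllPairs; AllPairs⇒Linked)
open import Data.Maybe using (just)
open import Data.Nat
open import Data.Nat.DivMod using (_divMod_; result)
open import Data.Nat.Divisibility
open import Data.Nat.Induction using (<-rec)
open import Data.Nat.ListAction using (sum; product)
open import Data.Nat.ListAction.Properties using (product-++)
open import Data.Nat.Primality
open import Data.Nat.Properties
open import Data.Nat.Tactic.RingSolver using (solve-∀)
open import Data.Product using (∃-syntax; _×_; _,_; proj₁; proj₂; uncurry)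
open import Data.Sum using (_⊎_; inj₁; inj₂)
open import Function.Base using (_∘_; _on_)
open import Function.Bundles using (_⇔_; mk⇔)
open import Relation.Binary.PropositionalEquality
  using (_≡_; _≢_; refl; sym; trans; cong; cong₂; subst; module ≡-Reasoning)
open import Relation.Nullary using (yes; no; contradiction)
open import Relation.Nullary.Decidable using (from-yes; from-no)
open import Algebra.Properties.CommutativeSemigroup *-commutativeSemigroup using (interchange)

^-distrib-* : ∀ x y n → (x * y) ^ n ≡ x ^ n * y ^ n
^-distrib-* x y zero    = refl
^-distrib-* x y (suc n) = trans (cong (x * y *_) (^-distrib-* x y n)) (interchange x y (x ^ n) (y ^ n))

infix 4 _^_∥_

_^_∥_ : ℕ → ℕ → ℕ → Set
q ^ e ∥ x = ∃[ u ] (x ≡ q ^ e * u × q ∤ u)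

module _ {q : ℕ} (q-prime : Prime q) where

  private instance
    q≢0 : NonZero q
    q≢0 = prime⇒nonZero q-prime

  q>1 : 1 < q
  q>1 = nonTrivial⇒n>1 q {{prime⇒nonTrivial q-prime}}

  ∤1 : q ∤ 1
  ∤1 q∣1 = <⇒≢ q>1 (sym (∣1⇒≡1 q∣1))

  ∤-* : ∀ {a b} → q ∤ a → q ∤ b → q ∤ a * b
  ∤-* {a} {b} q∤a q∤b q∣ab with euclidsLemma a b q-prime q∣ab
  ... | inj₁ q∣a = q∤a q∣a
  ... | inj₂ q∣b = q∤b q∣b

  ∤-^ : ∀ {a} k → q ∤ a → q ∤ a ^ k
  ∤-^ zero    _   = ∤1
  ∤-^ (suc k) q∤a = ∤-* q∤a (∤-^ k q∤a)

  ^*∤-injective : ∀ i j {a b} → q ^ i * a ≡ q ^ j * b → q ∤ a → q ∤ b → i ≡ j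
  ^*∤-injective zero    zero    eq q∤a q∤b = refl
  ^*∤-injective zero    (suc j) {a} {b} eq q∤a q∤b =
    contradiction (subst (q ∣_) (trans (sym eq) (*-identityˡ a)) (∣m⇒∣m*n b (m∣m*n (q ^ j)))) q∤a
  ^*∤-injective (suc i) zero    {a} {b} eq q∤a q∤b =
    contradiction (subst (q ∣_) (trans eq (*-identityˡ b)) (∣m⇒∣m*n a (m∣m*n (q ^ i)))) q∤b
  ^*∤-injective (suc i) (suc j) {a} {b} eq q∤a q∤b =
    cong suc (^*∤-injective i j (*-cancelˡ-≡ _ _ q (begin
      q * (q ^ i * a) ≡⟨ *-assoc q (q ^ i) a ⟨
      q * q ^ i * a   ≡⟨ eq ⟩
      q * q ^ j * b   ≡⟨ *-assoc q (q ^ j) b ⟩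
      q * (q ^ j * b) ∎)) q∤a q∤b)
    where open ≡-Reasoning

  q-adicSplit : ∀ R → .{{NonZero R}} → ∃[ e ] q ^ e ∥ R
  q-adicSplit = <-rec Split split
    where
    Split : ℕ → Set
    Split R = .{{NonZero R}} → ∃[ e ] q ^ e ∥ R

    split : ∀ R → (∀ {r} → r < R → Split r) → Split R
    split R rec with q ∣? R
    ... | no  q∤R = 0 , R , sym (+-identityʳ R) , q∤R
    ... | yes (divides r refl) with rec (m<m*n r q {{r≢0}} q>1) {{r≢0}}
      where r≢0 = m*n≢0⇒m≢0 r
    ...   | e , u , r≡ , q∤u = suc e , u , eq , q∤u
      where
      eq : r * q ≡ q * q ^ e * u
      eq = begin
        r * q           ≡⟨ *-comm r q ⟩
        q * r           ≡⟨ cong (q *_) r≡ ⟩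
        q * (q ^ e * u) ≡⟨ *-assoc q (q ^ e) u ⟨
        q * q ^ e * u   ∎
        where open ≡-Reasoning

  q^k*a≡R^M⇒M∣k : ∀ k {a} R M → q ∤ a → q ^ k * a ≡ R ^ M → M ∣ k
  q^k*a≡R^M⇒M∣k k R zero q∤a eq = subst (0 ∣_) (sym (^*∤-injective k 0 eq q∤a ∤1)) (0 ∣0)
  q^k*a≡R^M⇒M∣k k {a} zero (suc M) q∤a eq with m*n≡0⇒m≡0∨n≡0 (q ^ k) eq
  ... | inj₁ q^k≡0 = contradiction q^k≡0 (≢-nonZero⁻¹ _ {{m^n≢0 q k}})
  ... | inj₂ refl  = contradiction (q ∣0) q∤a
  q^k*a≡R^M⇒M∣k k {a} R@(suc _) M q∤a eq with q-adicSplit R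
  ... | e , u , R≡ , q∤u = subst (M ∣_) (^*∤-injective (e * M) k R^M≡ (∤-^ M q∤u) q∤a) (n∣m*n e)
    where
    R^M≡ : q ^ (e * M) * u ^ M ≡ q ^ k * a
    R^M≡ = begin
      q ^ (e * M) * u ^ M ≡⟨ cong (_* u ^ M) (^-*-assoc q e M) ⟨
      (q ^ e) ^ M * u ^ M ≡⟨ ^-distrib-* (q ^ e) u M ⟨
      (q ^ e * u) ^ M     ≡⟨ cong (_^ M) R≡ ⟨
      R ^ M               ≡⟨ eq ⟨
      q ^ k * a           ∎
      where open ≡-Reasoning

  ∥-product : ∀ (e : ℕ → ℕ) {l} → All (λ x → q ^ e x ∥ x) l → q ^ sum (map e l) ∥ product l
  ∥-product e []                          = 1 , refl , ∤1
  ∥-product e {x ∷ l} ((u , x≡ , q∤u) ∷ us) with ∥-product e us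
  ... | U , l≡ , q∤U = u * U , eq , ∤-* q∤u q∤U
    where
    eq : x * product l ≡ q ^ (e x + sum (map e l)) * (u * U)
    eq = begin
      x * product l                         ≡⟨ cong₂ _*_ x≡ l≡ ⟩
      q ^ e x * u * (q ^ sum (map e l) * U) ≡⟨ interchange (q ^ e x) u (q ^ sum (map e l)) U ⟩
      q ^ e x * q ^ sum (map e l) * (u * U) ≡⟨ cong (_* (u * U)) (^-distribˡ-+-* q (e x) _) ⟨
      q ^ (e x + sum (map e l)) * (u * U)   ∎
      where open ≡-Reasoning

  ∣-sumExponents : ∀ (e : ℕ → ℕ) {l} R M → All (λ x → q ^ e x ∥ x) l →
                   product l ≡ R ^ M → M ∣ sum (map e l)
  ∣-sumExponents e R M us prod =
    let U , l≡ , q∤U = ∥-product e us in q^k*a≡R^M⇒M∣k _ R M q∤U (trans (sym l≡) prod)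

multiplicity-++ : ∀ x xs ys → multiplicity x (xs ++ ys) ≡ multiplicity x xs + multiplicity x ys
multiplicity-++ x xs ys = trans (cong length (filter-++ (x ≟_) xs ys)) (length-++ (filter (x ≟_) xs))

multiplicity-here : ∀ x l → multiplicity x (x ∷ l) ≡ suc (multiplicity x l)
multiplicity-here x l = cong length (filter-accept (x ≟_) refl)

multiplicity-there : ∀ {x y} l → x ≢ y → multiplicity x (y ∷ l) ≡ multiplicity x l
multiplicity-there l x≢y = cong length (filter-reject (_ ≟_) x≢y)

sum-multiplicity-singletons : ∀ x l → sum (map (λ y → multiplicity x [ y ]) l) ≡ multiplicity x l
sum-multiplicity-singletons x []      = refl
sum-multiplicity-singletons x (y ∷ l) =
  trans (cong (multiplicity x [ y ] +_) (sum-multiplicity-singletons x l)) (sym (multiplicity-++ x [ y ] l))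

Linked-≤-last : ∀ {x xs s} → Linked _≤_ (x ∷ xs) → last (x ∷ xs) ≡ just s → All (_≤ s) (x ∷ xs)
Linked-≤-last [-]           refl = ≤-refl ∷ []
Linked-≤-last (x≤y ∷ sorted) ends with Linked-≤-last sorted ends
... | y≤s ∷ rest = ≤-trans x≤y y≤s ∷ y≤s ∷ rest

HasSeq-end≥ : ∀ {M n t} →
              (∀ {l R} → All (λ x → n ≤ x × x < t) l → product l ≡ R ^ M → M ∣ multiplicity n l) →
              ∀ {s} → HasSeq M n s → t ≤ s
HasSeq-end≥ {M} {n} {t} divisible {s} (rest , (sorted , (R , prod) , few) , ends) with t ≤? s
... | yes t≤s = t≤s
... | no  t≰s = contradiction (∣⇒≤ {{n-occurs}} (divisible inRange prod)) (<⇒≱ (few n))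
  where
  inRange : All (λ x → n ≤ x × x < t) (n ∷ rest)
  inRange = All.zip (Linked⇒All ≤-trans ≤-refl sorted ,
                     All.map (λ x≤s → ≤-<-trans x≤s (≰⇒> t≰s)) (Linked-≤-last sorted ends))
  n-occurs : NonZero (multiplicity n (n ∷ rest))
  n-occurs = subst NonZero (sym (multiplicity-here n rest)) _

∤-between : ∀ {p x} → p < x → x < 2 * p → p ∤ x
∤-between     p<x x<2p (divides zero          refl) = contradiction p<x n≮0
∤-between {p} p<x x<2p (divides (suc zero)    refl) = <-irrefl (sym (+-identityʳ p)) p<x
∤-between {p} p<x x<2p (divides (suc (suc k)) refl) = <⇒≱ x<2p (*-monoˡ-≤ p {2} {2 + k} (s≤s (s≤s z≤n)))

prime-∥ : ∀ {p x} → Prime p → p ≤ x → x < 2 * p → p ^ multiplicity p [ x ] ∥ x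
prime-∥ {p} {x} p-prime p≤x x<2p with p ≟ x
... | yes refl = 1 , sym (trans (cong (λ k → p ^ k * 1) (multiplicity-here p [])) p*1*1≡p) , ∤1 p-prime
  where
  p*1*1≡p : p * 1 * 1 ≡ p
  p*1*1≡p = trans (*-identityʳ (p * 1)) (*-identityʳ p)
... | no  p≢x = x , sym (trans (cong (λ k → p ^ k * x) (multiplicity-there [] p≢x)) (*-identityˡ x)) ,
                ∤-between (≤∧≢⇒< p≤x p≢x) x<2p

prime-end≥ : ∀ {M p s} → Prime p → HasSeq M p s → 2 * p ≤ s
prime-end≥ {M} {p} p-prime = HasSeq-end≥ λ {l} {R} inRange prod →
  subst (M ∣_) (sum-multiplicity-singletons p l)
    (∣-sumExponents p-prime (λ x → multiplicity p [ x ]) R M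
      (All.map (λ (p≤x , x<2p) → prime-∥ p-prime p≤x x<2p) inRange) prod)

-- Exponents of 2, 3 and 5 in 6, …, 11 (the value 0 elsewhere is junk).
ν₂ ν₃ ν₅ : ℕ → ℕ
ν₂ 6  = 1
ν₂ 8  = 3
ν₂ 10 = 1
ν₂ _  = 0
ν₃ 6  = 1
ν₃ 9  = 2
ν₃ _  = 0
ν₅ 10 = 1
ν₅ _  = 0

-- The weight 4 ν₂ + 3 ν₃ + 2 ν₅ is ≡ 1 (mod 6) at 6 and ≡ 0 (mod 6) at 7, …, 11.
Valuations₂₃₅ : ℕ → Set
Valuations₂₃₅ x = 2 ^ ν₂ x ∥ x × 3 ^ ν₃ x ∥ x × 5 ^ ν₅ x ∥ x ×
                ∃[ w ] (4 * ν₂ x + 3 * ν₃ x + 2 * ν₅ x ≡ multiplicity 6 [ x ] + 6 * w)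

valuations₂₃₅ : ∀ {x} → 6 ≤ x → x < 12 → Valuations₂₃₅ x
valuations₂₃₅ {x} 6≤x x<12 = subst Valuations₂₃₅ (m+[n∸m]≡n 6≤x) (offset (x ∸ 6) (∸-monoˡ-< x<12 6≤x))
  where
  offset : ∀ k → k < 6 → Valuations₂₃₅ (6 + k)
  offset 0 _ = (3 , refl , from-no (2 ∣? 3)) , (2 , refl , from-no (3 ∣? 2)) , (6 , refl , from-no (5 ∣? 6)) , 1 , refl
  offset 1 _ = (7 , refl , from-no (2 ∣? 7)) , (7 , refl , from-no (3 ∣? 7)) , (7 , refl , from-no (5 ∣? 7)) , 0 , refl
  offset 2 _ = (1 , refl , from-no (2 ∣? 1)) , (8 , refl , from-no (3 ∣? 8)) , (8 , refl , from-no (5 ∣? 8)) , 2 , refl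
  offset 3 _ = (9 , refl , from-no (2 ∣? 9)) , (1 , refl , from-no (3 ∣? 1)) , (9 , refl , from-no (5 ∣? 9)) , 1 , refl
  offset 4 _ = (5 , refl , from-no (2 ∣? 5)) , (10 , refl , from-no (3 ∣? 10)) , (2 , refl , from-no (5 ∣? 2)) , 1 , refl
  offset 5 _ = (11 , refl , from-no (2 ∣? 11)) , (11 , refl , from-no (3 ∣? 11)) , (11 , refl , from-no (5 ∣? 11)) , 0 , refl
  offset (suc (suc (suc (suc (suc (suc _)))))) (s≤s (s≤s (s≤s (s≤s (s≤s (s≤s ()))))))

sixWeights : ∀ {l} → All Valuations₂₃₅ l →
             ∃[ W ] (4 * sum (map ν₂ l) + 3 * sum (map ν₃ l) + 2 * sum (map ν₅ l) ≡ multiplicity 6 l + 6 * W)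
sixWeights []                             = 0 , refl
sixWeights {x ∷ l} ((_ , _ , _ , w , x≡) ∷ xs) with sixWeights xs
... | W , l≡ = w + W , (begin
  4 * (a₂ + b₂) + 3 * (a₃ + b₃) + 2 * (a₅ + b₅)            ≡⟨ regroup a₂ a₃ a₅ b₂ b₃ b₅ ⟩
  (4 * a₂ + 3 * a₃ + 2 * a₅) + (4 * b₂ + 3 * b₃ + 2 * b₅)  ≡⟨ cong₂ _+_ x≡ l≡ ⟩
  (multiplicity 6 [ x ] + 6 * w) + (multiplicity 6 l + 6 * W) ≡⟨ regroup′ (multiplicity 6 [ x ]) w (multiplicity 6 l) W ⟩
  (multiplicity 6 [ x ] + multiplicity 6 l) + 6 * (w + W)   ≡⟨ cong (_+ 6 * (w + W)) (multiplicity-++ 6 [ x ] l) ⟨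
  multiplicity 6 (x ∷ l) + 6 * (w + W)                      ∎)
  where
  open ≡-Reasoning
  a₂ = ν₂ x
  a₃ = ν₃ x
  a₅ = ν₅ x
  b₂ = sum (map ν₂ l)
  b₃ = sum (map ν₃ l)
  b₅ = sum (map ν₅ l)
  regroup : ∀ a₂ a₃ a₅ b₂ b₃ b₅ →
            4 * (a₂ + b₂) + 3 * (a₃ + b₃) + 2 * (a₅ + b₅) ≡ (4 * a₂ + 3 * a₃ + 2 * a₅) + (4 * b₂ + 3 * b₃ + 2 * b₅)
  regroup = solve-∀
  regroup′ : ∀ i w j W → (i + 6 * w) + (j + 6 * W) ≡ (i + j) + 6 * (w + W)
  regroup′ = solve-∀

six-∣multiplicity : ∀ {l R} → All (λ x → 6 ≤ x × x < 12) l → product l ≡ R ^ 6 → 6 ∣ multiplicity 6 l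
six-∣multiplicity {l} {R} inRange prod =
  let W , weights≡ = sixWeights facts
  in ∣m+n∣m⇒∣n (subst (6 ∣_) (trans weights≡ (+-comm _ (6 * W))) 6∣weights) (m∣m*n W)
  where
  facts = All.map (λ (6≤x , x<12) → valuations₂₃₅ 6≤x x<12) inRange
  6∣ν : ∀ {q} → Prime q → (ν : ℕ → ℕ) → (∀ {x} → Valuations₂₃₅ x → q ^ ν x ∥ x) → 6 ∣ sum (map ν l)
  6∣ν q-prime ν part = ∣-sumExponents q-prime ν R 6 (All.map part facts) prod
  6∣weights : 6 ∣ 4 * sum (map ν₂ l) + 3 * sum (map ν₃ l) + 2 * sum (map ν₅ l)
  6∣weights = ∣m∣n⇒∣m+n (∣m∣n⇒∣m+n (∣n⇒∣m*n 4 (6∣ν prime[2] ν₂ (λ (p , _) → p)))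
                                   (∣n⇒∣m*n 3 (6∣ν (from-yes (prime? 3)) ν₃ (λ (_ , p , _) → p))))
                        (∣n⇒∣m*n 2 (6∣ν (from-yes (prime? 5)) ν₅ (λ (_ , _ , p , _) → p)))

six-end≥ : ∀ {s} → HasSeq 6 6 s → 12 ≤ s
six-end≥ = HasSeq-end≥ (λ {l} {R} → six-∣multiplicity {l} {R})

expand : List (ℕ × ℕ) → List ℕ
expand []             = []
expand ((a , k) ∷ bs) = replicate k a ++ expand bs

product-replicate : ∀ k a → product (replicate k a) ≡ a ^ k
product-replicate zero    a = refl
product-replicate (suc k) a = cong (a *_) (product-replicate k a)

product-expand : ∀ bs → product (expand bs) ≡ product (map (uncurry _^_) bs)
product-expand []             = refl
product-expand ((a , k) ∷ bs) =
  trans (product-++ (replicate k a) (expand bs)) (cong₂ _*_ (product-replicate k a) (product-expand bs))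

All-expand : ∀ {P : ℕ → Set} {bs} → All (P ∘ proj₁) bs → All P (expand bs)
All-expand {bs = []}           []        = []
All-expand {bs = (a , k) ∷ bs} (pa ∷ ps) = All.++⁺ (All.replicate⁺ k pa) (All-expand ps)

AllPairs-replicate : ∀ k (a : ℕ) → AllPairs _≤_ (replicate k a)
AllPairs-replicate zero    a = []
AllPairs-replicate (suc k) a = All.replicate⁺ k ≤-refl ∷ AllPairs-replicate k a

AllPairs-expand : ∀ {bs} → AllPairs (_<_ on proj₁) bs → AllPairs _≤_ (expand bs)
AllPairs-expand {[]}           []            = []
AllPairs-expand {(a , k) ∷ bs} (a<bs ∷ pairs) =
  AllPairs.++⁺ (AllPairs-replicate k a) (AllPairs-expand pairs)
               (All.replicate⁺ k (All-expand (All.map <⇒≤ a<bs)))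

multiplicity-absent : ∀ {x l} → All (x ≢_) l → multiplicity x l ≡ 0
multiplicity-absent absent = cong length (filter-none (_ ≟_) absent)

multiplicity-replicate : ∀ k x → multiplicity x (replicate k x) ≤ k
multiplicity-replicate k x =
  subst (multiplicity x (replicate k x) ≤_) (length-replicate k) (length-filter (x ≟_) (replicate k x))

multiplicity-expand< : ∀ {M bs} → 0 < M → AllPairs (_<_ on proj₁) bs → All ((_< M) ∘ proj₂) bs →
                       ∀ x → multiplicity x (expand bs) < M
multiplicity-expand< {bs = []} 0<M [] [] x = 0<M
multiplicity-expand< {bs = (a , k) ∷ bs} 0<M (a<bs ∷ pairs) (k<M ∷ k<Ms) x
  rewrite multiplicity-++ x (replicate k a) (expand bs) with x ≟ a
... | yes refl rewrite multiplicity-absent (All-expand (All.map (λ x<b → <⇒≢ x<b) a<bs)) =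
  ≤-<-trans (≤-trans (≤-reflexive (+-identityʳ _)) (multiplicity-replicate k x)) k<M
... | no  x≢a rewrite multiplicity-absent (All.replicate⁺ k x≢a) = multiplicity-expand< 0<M pairs k<Ms x

last-replicate-++ : ∀ k {x : ℕ} ys → last (x ∷ replicate k x ++ ys) ≡ last (x ∷ ys)
last-replicate-++ zero    ys = refl
last-replicate-++ (suc k) ys = last-replicate-++ k ys

last-expand : ∀ {bs} → All ((0 <_) ∘ proj₂) bs → ∀ x → last (x ∷ expand bs) ≡ last (x ∷ map proj₁ bs)
last-expand {[]}                 []             x = refl
last-expand {(a , suc k) ∷ bs} (s≤s z≤n ∷ ps) x = trans (last-replicate-++ k (expand bs)) (last-expand ps a)

HasSeq-fromBlocks : ∀ {M s R} n k bs → let blocks = (n , k) ∷ bs in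
                    Linked (_<_ on proj₁) blocks → All (λ (_ , j) → 0 < j × j < M) blocks →
                    product (map (uncurry _^_) blocks) ≡ R ^ M → last (map proj₁ blocks) ≡ just s →
                    HasSeq M n s
HasSeq-fromBlocks {M} {s} {R} n (suc k) bs increasing counts@((_ , k<M) ∷ _) prod ends =
  replicate k n ++ expand bs ,
  (AllPairs⇒Linked (AllPairs-expand pairs) ,
   (R , trans (product-expand ((n , suc k) ∷ bs)) prod) ,
   multiplicity-expand< (≤-<-trans z≤n k<M) pairs (All.map proj₂ counts)) ,
  trans (last-replicate-++ k (expand bs)) (trans (last-expand (All.map proj₁ (All.tail counts)) n) ends)
  where
  pairs = Linked⇒AllPairs <-trans increasing

^-square : ∀ x m → (x * x) ^ m ≡ x ^ (2 * m)
^-square x m = trans (cong (λ y → (x * y) ^ m) (sym (*-identityʳ x))) (^-*-assoc x 2 m)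

product-uniform : ∀ m xs → product (map (uncurry _^_) (map (_, m) xs)) ≡ product xs ^ m
product-uniform m []       = sym (^-zeroˡ m)
product-uniform m (x ∷ xs) = trans (cong (x ^ m *_) (product-uniform m xs)) (sym (^-distrib-* x (product xs) m))

m<2*m : ∀ {m} → 0 < m → m < 2 * m
m<2*m {m} 0<m = m<m+n m (≤-trans 0<m (m≤m+n m 0))

HasSeq-uniform : ∀ {m s} R n xs → 0 < m → Linked _<_ (n ∷ xs) → product (n ∷ xs) ≡ R * R →
                 last (n ∷ xs) ≡ just s → HasSeq (2 * m) n s
HasSeq-uniform {m} R n xs 0<m increasing prod ends =
  HasSeq-fromBlocks n m (map (_, m) xs)
    (Linked.map⁺ increasing)
    (All.map⁺ (All.universal (λ _ → 0<m , m<2*m 0<m) (n ∷ xs)))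
    (begin
      product (map (uncurry _^_) (map (_, m) (n ∷ xs))) ≡⟨ product-uniform m (n ∷ xs) ⟩
      product (n ∷ xs) ^ m                               ≡⟨ cong (_^ m) prod ⟩
      (R * R) ^ m                                        ≡⟨ ^-square R m ⟩
      R ^ (2 * m)                                        ∎)
    (trans (cong last (trans (sym (map-∘ (n ∷ xs))) (map-id (n ∷ xs)))) ends)
  where open ≡-Reasoning

≡+suc⇒< : ∀ {a b} d → b ≡ a + suc d → a < b
≡+suc⇒< {a} d refl = m<m+n a (s≤s z≤n)

HasSeq-square : ∀ {m} a → 0 < m → HasSeq (2 * m) (a * a) (a * a)
HasSeq-square a 0<m = HasSeq-uniform a (a * a) [] 0<m [-] (*-identityʳ (a * a)) refl

HasSeq-rectangle : ∀ {m a b} → 0 < m → 0 < a → a < b → HasSeq (2 * m) (a * b) (suc a * suc b)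
HasSeq-rectangle {m} {a@(suc _)} {b} 0<m (s≤s z≤n) a<b =
  HasSeq-uniform (a * b * suc a * suc b) (a * b) (a * suc b ∷ suc a * b ∷ suc a * suc b ∷ [])
    0<m (ab<a[b+1] ∷ a[b+1]<[a+1]b ∷ [a+1]b<[a+1][b+1] ∷ [-]) (square a b) refl
  where
  ab<a[b+1] : a * b < a * suc b
  ab<a[b+1] = *-monoʳ-< a (n<1+n b)
  a[b+1]<[a+1]b : a * suc b < suc a * b
  a[b+1]<[a+1]b = subst (_< suc a * b) (sym (*-suc a b)) (+-monoˡ-< (a * b) a<b)
  [a+1]b<[a+1][b+1] : suc a * b < suc a * suc b
  [a+1]b<[a+1][b+1] = *-monoʳ-< (suc a) (n<1+n b)
  square : ∀ a b → a * b * (a * suc b * (suc a * b * (suc a * suc b * 1))) ≡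
                   a * b * suc a * suc b * (a * b * suc a * suc b)
  square = solve-∀

rectangle-end< : ∀ x y → (x , y) ≢ (0 , 0) → (3 + x) * (4 + x + y) < 2 * ((2 + x) * (3 + x + y))
rectangle-end< x y xy≢00 = subst ((3 + x) * (4 + x + y) <_) (sym (excess x y)) (m<m+n _ (positive x y xy≢00))
  where
  excess : ∀ x y → 2 * ((2 + x) * (3 + x + y)) ≡ (3 + x) * (4 + x + y) + (x * x + x * y + 3 * x + y)
  excess = solve-∀
  positive : ∀ x y → (x , y) ≢ (0 , 0) → 0 < x * x + x * y + 3 * x + y
  positive zero    zero    xy≢00 = contradiction refl xy≢00
  positive zero    (suc y) _     = s≤s z≤n
  positive (suc x) y       _     = s≤s z≤n

HasSeq-2 : ∀ {M} → 3 ≤ M → HasSeq M 2 4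
HasSeq-2 {suc (suc (suc K))} (s≤s (s≤s (s≤s z≤n))) =
  HasSeq-fromBlocks 2 (suc K) ((4 , 1) ∷ []) (from-yes (2 <? 4) ∷ [-])
    ((s≤s z≤n , n≤1+n (2 + K)) ∷ (s≤s z≤n , s≤s (s≤s z≤n)) ∷ []) (power (2 ^ K)) refl
  where
  power : ∀ x → 2 * x * (4 * 1) ≡ 2 * (2 * (2 * x))
  power = solve-∀

HasSeq-3 : ∀ {m} → 2 ≤ m → HasSeq (2 * m) 3 6
HasSeq-3 {suc a@(suc a′)} (s≤s (s≤s z≤n)) =
  HasSeq-fromBlocks 3 (2 * a) ((4 , a) ∷ (6 , 2) ∷ []) (from-yes (3 <? 4) ∷ from-yes (4 <? 6) ∷ [-])
    ((s≤s z≤n , ≡+suc⇒< 1 (count-3 a)) ∷ (s≤s z≤n , ≡+suc⇒< (suc a) (count-4 a)) ∷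
     (s≤s z≤n , ≡+suc⇒< (1 + 2 * a′) (count-6 a′)) ∷ [])
    (begin
      3 ^ (2 * a) * (4 ^ a * (6 ^ 2 * 1)) ≡⟨ cong (_* (4 ^ a * 36)) (^-*-assoc 3 2 a) ⟨
      9 ^ a * (4 ^ a * 36)                 ≡⟨ regroup (9 ^ a) (4 ^ a) ⟩
      36 * (9 ^ a * 4 ^ a)                 ≡⟨ cong (36 *_) (^-distrib-* 9 4 a) ⟨
      (6 * 6) ^ suc a                      ≡⟨ ^-square 6 (suc a) ⟩
      6 ^ (2 * suc a)                      ∎)
    refl
  where
  open ≡-Reasoning
  regroup : ∀ x y → x * (y * 36) ≡ 36 * (x * y)
  regroup = solve-∀
  count-3 : ∀ a → 2 * suc a ≡ 2 * a + 2
  count-3 = solve-∀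
  count-4 : ∀ a → 2 * suc a ≡ a + suc (suc a)
  count-4 = solve-∀
  count-6 : ∀ a′ → 2 * suc (suc a′) ≡ 2 + suc (1 + 2 * a′)
  count-6 = solve-∀

HasSeq-twiceSquare : ∀ {m p} j → 0 < m → p < 2 * (j * j) → 2 * (j * j) < 2 * p → HasSeq (2 * m) p (2 * p)
HasSeq-twiceSquare {p = p} j 0<m p<2j² 2j²<2p =
  HasSeq-uniform (2 * p * j) p (2 * (j * j) ∷ 2 * p ∷ []) 0<m (p<2j² ∷ 2j²<2p ∷ [-]) (square p j) refl
  where
  square : ∀ p j → p * (2 * (j * j) * (2 * p * 1)) ≡ 2 * p * j * (2 * p * j)
  square = solve-∀

twiceSquare-between : ∀ d → ∃[ j ] (10 + d < 2 * (j * j) × 2 * (j * j) < 2 * (10 + d))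
twiceSquare-between zero = 3 , from-yes (10 <? 18) , from-yes (18 <? 20)
twiceSquare-between (suc d) with twiceSquare-between d
... | j , n<2j² , 2j²<2n with 11 + d <? 2 * (j * j)
...   | yes n+1<2j² = j , n+1<2j² , <-trans 2j²<2n (*-monoʳ-< 2 (n<1+n (10 + d)))
...   | no  n+1≮2j² = next j (≤-antisym (≮⇒≥ n+1≮2j²) n<2j²)
  where
  -- When 2 j² = n + 1, the next twice-square 2 (j + 1)² is still below 2 (n + 1) as j ≥ 3.
  next : ∀ j → 2 * (j * j) ≡ 11 + d → ∃[ j′ ] (11 + d < 2 * (j′ * j′) × 2 * (j′ * j′) < 2 * (11 + d))
  next (suc (suc (suc t))) 2j²≡n+1 =
    subst (λ n → ∃[ j′ ] (n < 2 * (j′ * j′) × 2 * (j′ * j′) < 2 * n)) 2j²≡n+1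
      (4 + t , ≡+suc⇒< (13 + 4 * t) (above t) , ≡+suc⇒< (3 + 8 * t + 2 * (t * t)) (below t))
    where
    above : ∀ t → 2 * ((4 + t) * (4 + t)) ≡ 2 * ((3 + t) * (3 + t)) + suc (13 + 4 * t)
    above = solve-∀
    below : ∀ t → 2 * (2 * ((3 + t) * (3 + t))) ≡ 2 * ((4 + t) * (4 + t)) + suc (3 + 8 * t + 2 * (t * t))
    below = solve-∀

HasSeq-prime : ∀ {m p} → 2 ≤ m → Prime p → HasSeq (2 * m) p (2 * p)
HasSeq-prime {m} {p} 2≤m p-prime = fromPrime p p-prime
  where
  0<m = ≤-trans (s≤s z≤n) 2≤m
  fromPrime : ∀ p → Prime p → HasSeq (2 * m) p (2 * p)
  fromPrime 2 _ = HasSeq-2 (≤-trans (n≤1+n 3) (*-monoʳ-≤ 2 2≤m))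
  fromPrime 3 _ = HasSeq-3 2≤m
  fromPrime 4 4-prime = contradiction composite[4] (prime⇒¬composite 4-prime)
  fromPrime 5 _ = HasSeq-twiceSquare 2 0<m (from-yes (5 <? 8)) (from-yes (8 <? 10))
  fromPrime 6 6-prime = contradiction composite[6] (prime⇒¬composite 6-prime)
  fromPrime 7 _ = HasSeq-twiceSquare 2 0<m (from-yes (7 <? 8)) (from-yes (8 <? 14))
  fromPrime 8 8-prime = contradiction (composite-≢ 2 (λ ()) (divides-refl 4)) (prime⇒¬composite 8-prime)
  fromPrime 9 9-prime = contradiction (composite-≢ 3 (λ ()) (divides-refl 3)) (prime⇒¬composite 9-prime)
  fromPrime (suc (suc (suc (suc (suc (suc (suc (suc (suc (suc d)))))))))) _ =
    let j , p<2j² , 2j²<2p = twiceSquare-between d in HasSeq-twiceSquare j 0<m p<2j² 2j²<2p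

HasSeq-6-12 : HasSeq 6 6 12
HasSeq-6-12 = HasSeq-uniform {3} 24 6 (8 ∷ 12 ∷ []) (s≤s z≤n) (from-yes (6 <? 8) ∷ from-yes (8 <? 12) ∷ [-]) refl refl

^-*-^ : ∀ a b e f k → a ^ (e * k) * b ^ (f * k) ≡ (a ^ e * b ^ f) ^ k
^-*-^ a b e f k = trans (sym (cong₂ _*_ (^-*-assoc a e k) (^-*-assoc b f k))) (sym (^-distrib-* (a ^ e) (b ^ f) k))

^-+-* : ∀ c a e k → c ^ a * (c ^ e) ^ k ≡ c ^ (a + e * k)
^-+-* c a e k = trans (cong (c ^ a *_) (^-*-assoc c e k)) (sym (^-distribˡ-+-* c a (e * k)))

-- Sequences 6ᵃ 8ᵇ 9ᶜ: as 8² · 9³ = 6⁶ and 8⁴ · 9³ = 12⁶, the exponents are balanced according to m mod 3.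
HasSeq-6-9₀ : ∀ k → HasSeq (2 * ((2 + k) * 3)) 6 9
HasSeq-6-9₀ k =
  HasSeq-fromBlocks 6 6 ((8 , 2 * suc k) ∷ (9 , 3 * suc k) ∷ []) (from-yes (6 <? 8) ∷ from-yes (8 <? 9) ∷ [-])
    ((s≤s z≤n , ≡+suc⇒< (5 + 6 * k) (count-6 k)) ∷ (s≤s z≤n , ≡+suc⇒< (9 + 4 * k) (count-8 k)) ∷
     (s≤s z≤n , ≡+suc⇒< (8 + 3 * k) (count-9 k)) ∷ [])
    (begin
      6 ^ 6 * (8 ^ (2 * suc k) * (9 ^ (3 * suc k) * 1)) ≡⟨ cong (λ x → 6 ^ 6 * (8 ^ (2 * suc k) * x)) (*-identityʳ _) ⟩
      6 ^ 6 * (8 ^ (2 * suc k) * 9 ^ (3 * suc k))       ≡⟨ cong (6 ^ 6 *_) (^-*-^ 8 9 2 3 (suc k)) ⟩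
      6 ^ 6 * (6 ^ 6) ^ suc k                           ≡⟨ ^-+-* 6 6 6 (suc k) ⟩
      6 ^ (6 + 6 * suc k)                               ≡⟨ cong (6 ^_) (exponent k) ⟩
      6 ^ (2 * ((2 + k) * 3))                           ∎)
    refl
  where
  open ≡-Reasoning
  count-6 : ∀ k → 2 * ((2 + k) * 3) ≡ 6 + suc (5 + 6 * k)
  count-6 = solve-∀
  count-8 : ∀ k → 2 * ((2 + k) * 3) ≡ 2 * suc k + suc (9 + 4 * k)
  count-8 = solve-∀
  count-9 : ∀ k → 2 * ((2 + k) * 3) ≡ 3 * suc k + suc (8 + 3 * k)
  count-9 = solve-∀
  exponent : ∀ k → 6 + 6 * suc k ≡ 2 * ((2 + k) * 3)
  exponent = solve-∀

HasSeq-6-9₁ : ∀ k → HasSeq (2 * (1 + suc k * 3)) 6 9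
HasSeq-6-9₁ k =
  HasSeq-fromBlocks 6 2 ((8 , 2 * suc k) ∷ (9 , 3 * suc k) ∷ []) (from-yes (6 <? 8) ∷ from-yes (8 <? 9) ∷ [-])
    ((s≤s z≤n , ≡+suc⇒< (5 + 6 * k) (count-6 k)) ∷ (s≤s z≤n , ≡+suc⇒< (5 + 4 * k) (count-8 k)) ∷
     (s≤s z≤n , ≡+suc⇒< (4 + 3 * k) (count-9 k)) ∷ [])
    (begin
      6 ^ 2 * (8 ^ (2 * suc k) * (9 ^ (3 * suc k) * 1)) ≡⟨ cong (λ x → 6 ^ 2 * (8 ^ (2 * suc k) * x)) (*-identityʳ _) ⟩
      6 ^ 2 * (8 ^ (2 * suc k) * 9 ^ (3 * suc k))       ≡⟨ cong (6 ^ 2 *_) (^-*-^ 8 9 2 3 (suc k)) ⟩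
      6 ^ 2 * (6 ^ 6) ^ suc k                           ≡⟨ ^-+-* 6 2 6 (suc k) ⟩
      6 ^ (2 + 6 * suc k)                               ≡⟨ cong (6 ^_) (exponent k) ⟩
      6 ^ (2 * (1 + suc k * 3))                         ∎)
    refl
  where
  open ≡-Reasoning
  count-6 : ∀ k → 2 * (1 + suc k * 3) ≡ 2 + suc (5 + 6 * k)
  count-6 = solve-∀
  count-8 : ∀ k → 2 * (1 + suc k * 3) ≡ 2 * suc k + suc (5 + 4 * k)
  count-8 = solve-∀
  count-9 : ∀ k → 2 * (1 + suc k * 3) ≡ 3 * suc k + suc (4 + 3 * k)
  count-9 = solve-∀
  exponent : ∀ k → 2 + 6 * suc k ≡ 2 * (1 + suc k * 3)
  exponent = solve-∀

HasSeq-6-9₂ : ∀ k → HasSeq (2 * (2 + k * 3)) 6 9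
HasSeq-6-9₂ k =
  HasSeq-fromBlocks 6 2 ((8 , 2 + 4 * k) ∷ (9 , 1 + 3 * k) ∷ []) (from-yes (6 <? 8) ∷ from-yes (8 <? 9) ∷ [-])
    ((s≤s z≤n , ≡+suc⇒< (1 + 6 * k) (count-6 k)) ∷ (s≤s z≤n , ≡+suc⇒< (1 + 2 * k) (count-8 k)) ∷
     (s≤s z≤n , ≡+suc⇒< (2 + 3 * k) (count-9 k)) ∷ [])
    (begin
      6 ^ 2 * (8 ^ (2 + 4 * k) * (9 ^ (1 + 3 * k) * 1))
        ≡⟨ cong (λ x → 6 ^ 2 * (x * (9 ^ (1 + 3 * k) * 1))) (^-distribˡ-+-* 8 2 (4 * k)) ⟩
      6 ^ 2 * (8 ^ 2 * 8 ^ (4 * k) * (9 * 9 ^ (3 * k) * 1))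
        ≡⟨ regroup (8 ^ (4 * k)) (9 ^ (3 * k)) ⟩
      12 ^ 4 * (8 ^ (4 * k) * 9 ^ (3 * k))
        ≡⟨ cong (12 ^ 4 *_) (^-*-^ 8 9 4 3 k) ⟩
      12 ^ 4 * (12 ^ 6) ^ k
        ≡⟨ ^-+-* 12 4 6 k ⟩
      12 ^ (4 + 6 * k)
        ≡⟨ cong (12 ^_) (exponent k) ⟩
      12 ^ (2 * (2 + k * 3))
        ∎)
    refl
  where
  open ≡-Reasoning
  regroup : ∀ x y → 36 * (64 * x * (9 * y * 1)) ≡ 20736 * (x * y)
  regroup = solve-∀
  count-6 : ∀ k → 2 * (2 + k * 3) ≡ 2 + suc (1 + 6 * k)
  count-6 = solve-∀
  count-8 : ∀ k → 2 * (2 + k * 3) ≡ (2 + 4 * k) + suc (1 + 2 * k)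
  count-8 = solve-∀
  count-9 : ∀ k → 2 * (2 + k * 3) ≡ (1 + 3 * k) + suc (2 + 3 * k)
  count-9 = solve-∀
  exponent : ∀ k → 4 + 6 * k ≡ 2 * (2 + k * 3)
  exponent = solve-∀

HasSeq-6-9 : ∀ {m} → 2 ≤ m → m ≢ 3 → HasSeq (2 * m) 6 9
HasSeq-6-9 {m} 2≤m m≢3 with m divMod 3
... | result zero          zero             refl = contradiction 2≤m λ ()
... | result (suc zero)    zero             refl = contradiction refl m≢3
... | result (suc (suc k)) zero             refl = HasSeq-6-9₀ k
... | result zero          (suc zero)       refl = contradiction 2≤m λ { (s≤s ()) }
... | result (suc k)       (suc zero)       refl = HasSeq-6-9₁ k
... | result k             (suc (suc zero)) refl = HasSeq-6-9₂ k

ShortSeq : ℕ → ℕ → Set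
ShortSeq M n = ∃[ s ] (s < 2 * n × HasSeq M n s)

Composite⇒factors : ∀ {n} → Composite n → ∃[ a ] ∃[ b ] (2 ≤ a × a ≤ b × n ≡ a * b)
Composite⇒factors (composite {d} d<n (divides zero refl)) = contradiction d<n n≮0
Composite⇒factors (composite {d} d<n (divides (suc zero) refl)) = contradiction d<n (<-irrefl (sym (+-identityʳ d)))
Composite⇒factors (composite {d} d<n (divides q@(suc (suc _)) refl)) with ≤-total d q
... | inj₁ d≤q = d , q , nonTrivial⇒n>1 d , d≤q , *-comm q d
... | inj₂ q≤d = q , d , s≤s (s≤s z≤n) , q≤d , refl

ShortSeq-rectangle : ∀ {m} → 2 ≤ m → ∀ x y → (x , y) ≢ (0 , 0) → ShortSeq (2 * m) ((2 + x) * (3 + x + y))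
ShortSeq-rectangle 2≤m x y xy≢00 =
  (3 + x) * (4 + x + y) , rectangle-end< x y xy≢00 ,
  HasSeq-rectangle (≤-trans (s≤s z≤n) 2≤m) (s≤s z≤n) (m≤m+n (3 + x) y)

classifyRectangle : ∀ {m} → 2 ≤ m → ∀ x y →
                    (2 * m ≡ 6 × (2 + x) * (3 + x + y) ≡ 6) ⊎ ShortSeq (2 * m) ((2 + x) * (3 + x + y))
classifyRectangle {m} 2≤m zero    zero    with m ≟ 3
... | yes refl = inj₁ (refl , refl)
... | no  m≢3  = inj₂ (9 , from-yes (9 <? 12) , HasSeq-6-9 2≤m m≢3)
classifyRectangle     2≤m zero    (suc y) = inj₂ (ShortSeq-rectangle 2≤m zero (suc y) λ ())
classifyRectangle     2≤m (suc x) y       = inj₂ (ShortSeq-rectangle 2≤m (suc x) y λ ())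

classifyFactors : ∀ {m a b} → 2 ≤ m → 2 ≤ a → a ≤ b → (2 * m ≡ 6 × a * b ≡ 6) ⊎ ShortSeq (2 * m) (a * b)
classifyFactors {a = a@(suc (suc x))} 2≤m (s≤s (s≤s z≤n)) a≤b with m≤n⇒m<n∨m≡n a≤b
... | inj₂ refl = inj₂ (a * a , m<2*m (s≤s z≤n) , HasSeq-square a (≤-trans (s≤s z≤n) 2≤m))
... | inj₁ a<b with m≤n⇒∃[o]m+o≡n a<b
...   | y , refl = classifyRectangle 2≤m x y

classify : ∀ {m} → 2 ≤ m → ∀ n → (Prime n ⊎ n ≡ 0 ⊎ (2 * m ≡ 6 × n ≡ 6)) ⊎ ShortSeq (2 * m) n
classify 2≤m 0 = inj₁ (inj₂ (inj₁ refl))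
classify 2≤m 1 = inj₂ (1 , from-yes (1 <? 2) , HasSeq-square 1 (≤-trans (s≤s z≤n) 2≤m))
classify {m} 2≤m n@(suc (suc _)) with prime? n
... | yes n-prime = inj₁ (inj₁ n-prime)
... | no  ¬prime with Composite⇒factors (¬prime⇒composite ¬prime)
...   | a , b , 2≤a , a≤b , n≡ab with classifyFactors 2≤m 2≤a a≤b
...     | inj₁ (2m≡6 , ab≡6) = inj₁ (inj₂ (inj₂ (2m≡6 , trans n≡ab ab≡6)))
...     | inj₂ short          = inj₂ (subst (ShortSeq (2 * m)) (sym n≡ab) short)

theorem4p13 : ∀ (m n : ℕ) → 2 ≤ m →
    (GEq (2 * m) n (2 * n) ⇔ (Prime n ⊎ n ≡ 0 ⊎ (2 * m ≡ 6 × n ≡ 6)))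
theorem4p13 m n 2≤m = mk⇔ minimal⇒ ⇒minimal
  where
  minimal⇒ : GEq (2 * m) n (2 * n) → Prime n ⊎ n ≡ 0 ⊎ (2 * m ≡ 6 × n ≡ 6)
  minimal⇒ (_ , least) with classify 2≤m n
  ... | inj₁ exceptional      = exceptional
  ... | inj₂ (s , s<2n , seq) = contradiction (least s seq) (<⇒≱ s<2n)

  ⇒minimal : Prime n ⊎ n ≡ 0 ⊎ (2 * m ≡ 6 × n ≡ 6) → GEq (2 * m) n (2 * n)
  ⇒minimal (inj₁ n-prime)            = HasSeq-prime 2≤m n-prime , λ _ → prime-end≥ n-prime
  ⇒minimal (inj₂ (inj₁ refl))        = HasSeq-square 0 (≤-trans (s≤s z≤n) 2≤m) , λ _ _ → z≤n
  ⇒minimal (inj₂ (inj₂ (2m≡6 , refl))) = subst (λ M → GEq M 6 12) (sym 2m≡6) (HasSeq-6-12 , λ _ → six-end≥)
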